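{- Let $A_1,B_1\in\mathbb{F}_q^{a\times u}$ and $A_2,B_2\in\mathbb{F}_q^{u\times b}$ with $\mathrm{rk}(A_1)=\mathrm{rk}(A_2)=\mathrm{rk}(B_1)=\mathrm{rk}(B_2)=u$. Then $$d_S(\tau^{ -1}(A_1^T),\tau^{ -1}(B_1^T))+d_S(\tau^{ -1}(A_2),\tau^{ -1}(B_2))\le 2\,\mathrm{rk}(A_1A_2-B_1B_2).$$
   Context: For a matrix $X$ of full row rank, $\tau^{ -1}(X)$ denotes its row space. For subspaces $U,W$ of a common vector space, $d_S(U,W)=\dim(U+W)-\dim(U\cap W)$. -}

module Defs where

open import Level using (Level; _⊔_; suc)
open import Algebra.Bundles using (CommutativeRing)
open import Data.Nat using (ℕ; zero) renaming (suc to 1+)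
open import Data.Fin using (Fin) renaming (zero to fz; suc to fs)
open import Data.Product using (Σ; ∃; _×_; _,_)
open import Relation.Nullary using (¬_)

record Field (c ℓ : Level) : Set (suc (c ⊔ ℓ)) where
  field
    commutativeRing : CommutativeRing c ℓ
  open CommutativeRing commutativeRing public
  field
    0≉1     : ¬ (0# ≈ 1#)
    inverse : ∀ x → ¬ (x ≈ 0#) → ∃ λ y → (x * y) ≈ 1#

record FiniteField (c ℓ : Level) : Set (suc (c ⊔ ℓ)) where
  field
    field′ : Field c ℓ
  open Field field′ public
  field
    q         : ℕ
    enum      : Fin q → Carrier
    enum-onto : ∀ x → ∃ λ i → enum i ≈ x

module LinAlg {c ℓ : Level} (F : FiniteField c ℓ) where
  open FiniteField F

  Vector : ℕ → Set c
  Vector n = Fin n → Carrier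

  Matrix : ℕ → ℕ → Set c
  Matrix m n = Fin m → Fin n → Carrier

  ∑ : ∀ {n} → (Fin n → Carrier) → Carrier
  ∑ {zero}  f = 0#
  ∑ {1+ n} f = f fz + ∑ (λ i → f (fs i))

  _ᵀ : ∀ {m n} → Matrix m n → Matrix n m
  (A ᵀ) i j = A j i

  _⊗_ : ∀ {m k n} → Matrix m k → Matrix k n → Matrix m n
  (A ⊗ B) i j = ∑ (λ l → A i l * B l j)

  _⊖_ : ∀ {m n} → Matrix m n → Matrix m n → Matrix m n
  (A ⊖ B) i j = A i j - B i j

  _≈ᵥ_ : ∀ {n} → Vector n → Vector n → Set ℓ
  u ≈ᵥ v = ∀ j → u j ≈ v j

  _+ᵥ_ : ∀ {n} → Vector n → Vector n → Vector n
  (u +ᵥ v) j = u j + v j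

  lincomb : ∀ {k n} → (Fin k → Carrier) → (Fin k → Vector n) → Vector n
  lincomb cs v j = ∑ (λ i → cs i * v i j)

  -- subsets of F^n (subspaces are given as predicates)
  Pred : ℕ → Set (suc (c ⊔ ℓ))
  Pred n = Vector n → Set (c ⊔ ℓ)

  LinIndep : ∀ {k n} → (Fin k → Vector n) → Set (c ⊔ ℓ)
  LinIndep v = ∀ cs → (∀ j → lincomb cs v j ≈ 0#) → ∀ i → cs i ≈ 0#

  Spans : ∀ {k n} → (Fin k → Vector n) → Pred n → Set (c ⊔ ℓ)
  Spans v U = ∀ x → U x → ∃ λ cs → x ≈ᵥ lincomb cs v

  HasDim : ∀ {n} → Pred n → ℕ → Set (c ⊔ ℓ)
  HasDim {n} U d = Σ (Fin d → Vector n) λ v →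
    (∀ i → U (v i)) × LinIndep v × Spans v U

  -- τ⁻¹(X): the row space of X
  RowSpace : ∀ {m n} → Matrix m n → Pred n
  RowSpace {m} X x = ∃ λ (cs : Fin m → Carrier) → x ≈ᵥ lincomb cs X

  Rank : ∀ {m n} → Matrix m n → ℕ → Set (c ⊔ ℓ)
  Rank X r = HasDim (RowSpace X) r

  _⊕ₛ_ : ∀ {n} → Pred n → Pred n → Pred n
  (U ⊕ₛ W) x = ∃ λ y → ∃ λ z → U y × W z × (x ≈ᵥ (y +ᵥ z))

  _∩ₛ_ : ∀ {n} → Pred n → Pred n → Pred n
  (U ∩ₛ W) x = U x × W x

-- Write U₁ = τ⁻¹(A₁ᵀ), W₁ = τ⁻¹(B₁ᵀ) and U₂ = τ⁻¹(A₂), W₂ = τ⁻¹(B₂). By the rank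
-- hypotheses all four have dimension u, so Grassmann's formula gives
-- d_S(U,W) = 2 dim(U+W) − 2u = 2u − 2 dim(U∩W), and it suffices to show
-- dim(U₁+W₁) ≤ rk M + dim(U₂∩W₂) for M = A₁A₂ − B₁B₂. Put X = [A₁ | B₁] and
-- Φ = [A₂ ; −B₂], so that XΦ = M and U₁+W₁ is the column space of X. The kernel of
-- h ↦ hΦ is spanned by dim(U₂∩W₂) vectors, hence every row of X lies in the span of
-- rk M preimages of a basis of τ⁻¹(M) together with these kernel vectors, and the
-- column rank of X is at most their number.
--
-- Equality in 𝔽 is not decidable, so
-- independence arguments by contradiction only yield double-negated statements. All
-- conclusions are inequalities between natural numbers, which are stable, so the
-- argument runs in the double-negation monad.

module Submission where

open import Defs
open import Level using (Level; _⊔_)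
import Data.Nat as ℕ
open ℕ using (ℕ; zero; suc; _≤_; z≤n; s≤s; _≤?_)
open import Data.Nat.Properties
  using (≤-antisym; m≤n⇒m≤1+n; 1+n≰n; +-cancelʳ-≤; +-mono-≤; m+[n∸m]≡n; module ≤-Reasoning)
open import Data.Nat.Tactic.RingSolver using (solve-∀)
open import Data.Fin using (Fin; punchIn; punchOut; _↑ˡ_; _↑ʳ_; splitAt)
  renaming (zero to fz; suc to fs)
open import Data.Fin.Properties using (all?; ¬∀⟶∃¬; ∀-cons; join-splitAt; punchIn-punchOut)
  renaming (_≟_ to _≟ᶠ_)
open import Data.Vec.Functional using (_++_; take; drop; tail; insertAt)
open import Data.Vec.Functional.Properties
  using (lookup-++ˡ; lookup-++ʳ; insertAt-lookup; insertAt-punchIn)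
open import Data.Product using (∃; _,_; proj₁; proj₂)
open import Data.Sum using (inj₁; inj₂)
open import Data.Empty using (⊥-elim)
open import Function using (_∘_; _$_; case_of_)
open import Relation.Nullary using (¬_; Dec; yes; no)
open import Relation.Nullary.Negation using (contradiction; ¬¬-map; negated-stable)
open import Relation.Nullary.Decidable using (decidable-stable; ¬¬-excluded-middle)
open import Relation.Binary.PropositionalEquality using (_≡_)
import Relation.Binary.PropositionalEquality as ≡

private
  variable
    a b p : Level
    A : Set a
    B : Set b

infixl 1 _>>=_

_>>=_ : ¬ ¬ A → (A → ¬ ¬ B) → ¬ ¬ B
m >>= f = negated-stable (¬¬-map f m)

return : A → ¬ ¬ A
return = contradiction

¬¬-∀Fin : ∀ {n} {P : Fin n → Set p} → (∀ i → ¬ ¬ P i) → ¬ ¬ (∀ i → P i)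
¬¬-∀Fin {n = zero}  _ = return λ ()
¬¬-∀Fin {n = suc n} h = do
  p₀ ← h fz
  ps ← ¬¬-∀Fin (h ∘ fs)
  return (∀-cons p₀ ps)

≤-stable : ∀ {m n} → ¬ ¬ (m ≤ n) → m ≤ n
≤-stable = decidable-stable (_ ≤? _)

splitAt-elim : ∀ m {n} {P : Fin (m ℕ.+ n) → Set p} →
  (∀ l → P (l ↑ˡ n)) → (∀ r → P (m ↑ʳ r)) → ∀ q → P q
splitAt-elim m {n} Pˡ Pʳ q with splitAt m q | join-splitAt m n q
... | inj₁ l | ≡.refl = Pˡ l
... | inj₂ r | ≡.refl = Pʳ r

module LinearAlgebra {c ℓ : Level} (F : FiniteField c ℓ) where
  open FiniteField F
  open LinAlg F
  open import Relation.Binary.Reasoning.Setoid setoid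
  open import Algebra.Properties.Ring ring using (-‿distribˡ-*; -‿distribʳ-*)
  open import Algebra.Properties.Group +-group
    using (ε⁻¹≈ε; ⁻¹-involutive; x∙y⁻¹≈ε⇒x≈y; x≈y⇒x∙y⁻¹≈ε; inverseˡ-unique)
  open import Algebra.Properties.AbelianGroup +-abelianGroup using (⁻¹-∙-comm)
  open import Algebra.Properties.CommutativeSemigroup +-commutativeSemigroup
    using (interchange; x∙yz≈y∙xz)

  -- Finite sums

  x-y+y≈x : ∀ x y → x - y + y ≈ x
  x-y+y≈x x y = trans (+-assoc _ _ _) (trans (+-congˡ (-‿inverseˡ y)) (+-identityʳ x))

  ∑-cong : ∀ {n} {f g : Fin n → Carrier} → (∀ i → f i ≈ g i) → ∑ f ≈ ∑ g
  ∑-cong {zero}  _   = refl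
  ∑-cong {suc n} f≈g = +-cong (f≈g fz) (∑-cong (f≈g ∘ fs))

  ∑-0 : ∀ {n} {f : Fin n → Carrier} → (∀ i → f i ≈ 0#) → ∑ f ≈ 0#
  ∑-0 {zero}  _   = refl
  ∑-0 {suc n} f≈0 = trans (+-cong (f≈0 fz) (∑-0 (f≈0 ∘ fs))) (+-identityʳ 0#)

  ∑-distrib-+ : ∀ {n} (f g : Fin n → Carrier) → ∑ (λ i → f i + g i) ≈ ∑ f + ∑ g
  ∑-distrib-+ {zero}  _ _ = sym (+-identityʳ 0#)
  ∑-distrib-+ {suc n} f g = trans (+-congˡ (∑-distrib-+ (f ∘ fs) (g ∘ fs))) (interchange _ _ _ _)

  -‿distrib-∑ : ∀ {n} (f : Fin n → Carrier) → - ∑ f ≈ ∑ (λ i → - f i)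
  -‿distrib-∑ {zero}  _ = ε⁻¹≈ε
  -‿distrib-∑ {suc n} f = trans (sym (⁻¹-∙-comm _ _)) (+-congˡ (-‿distrib-∑ (f ∘ fs)))

  *-distribˡ-∑ : ∀ {n} x (f : Fin n → Carrier) → x * ∑ f ≈ ∑ (λ i → x * f i)
  *-distribˡ-∑ {zero}  x _ = zeroʳ x
  *-distribˡ-∑ {suc n} x f = trans (distribˡ x _ _) (+-congˡ (*-distribˡ-∑ x (f ∘ fs)))

  *-distribʳ-∑ : ∀ {n} x (f : Fin n → Carrier) → ∑ f * x ≈ ∑ (λ i → f i * x)
  *-distribʳ-∑ x f = trans (*-comm _ x) (trans (*-distribˡ-∑ x f) (∑-cong λ i → *-comm x (f i)))

  ∑-comm : ∀ {m n} (f : Fin m → Fin n → Carrier) →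
    ∑ (λ i → ∑ (f i)) ≈ ∑ (λ j → ∑ (λ i → f i j))
  ∑-comm {zero}  {n} _ = sym (∑-0 {n} λ _ → refl)
  ∑-comm {suc m}     f = trans (+-congˡ (∑-comm (f ∘ fs))) (sym (∑-distrib-+ (f fz) _))

  ∑-punchIn : ∀ {n} (q : Fin (suc n)) (f : Fin (suc n) → Carrier) → ∑ f ≈ f q + ∑ (f ∘ punchIn q)
  ∑-punchIn         fz     f = refl
  ∑-punchIn {suc n} (fs q) f = trans (+-congˡ (∑-punchIn q (f ∘ fs))) (x∙yz≈y∙xz _ _ _)

  ∑-↑ : ∀ m {n} (f : Fin (m ℕ.+ n) → Carrier) → ∑ f ≈ ∑ (take m f) + ∑ (drop m f)
  ∑-↑ zero    f = sym (+-identityˡ (∑ f))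
  ∑-↑ (suc m) f = trans (+-congˡ (∑-↑ m (f ∘ fs))) (sym (+-assoc _ _ _))

  ∑-sub-scaled : ∀ {n} (d y e : Fin n → Carrier) x →
    ∑ (λ i → d i * (y i - e i * x)) ≈ ∑ (λ i → d i * y i) - ∑ (λ i → d i * e i) * x
  ∑-sub-scaled d y e x = begin
    ∑ (λ i → d i * (y i - e i * x))
      ≈⟨ ∑-cong (λ i → trans (distribˡ (d i) (y i) (- (e i * x)))
                             (+-congˡ (sym (-‿distribʳ-* (d i) (e i * x))))) ⟩
    ∑ (λ i → d i * y i + - (d i * (e i * x)))
      ≈⟨ ∑-distrib-+ (λ i → d i * y i) (λ i → - (d i * (e i * x))) ⟩
    ∑ (λ i → d i * y i) + ∑ (λ i → - (d i * (e i * x)))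
      ≈⟨ +-congˡ (sym (-‿distrib-∑ (λ i → d i * (e i * x)))) ⟩
    ∑ (λ i → d i * y i) - ∑ (λ i → d i * (e i * x))
      ≈⟨ +-congˡ (-‿cong (trans (∑-cong λ i → sym (*-assoc (d i) (e i) x))
                                (sym (*-distribʳ-∑ x (λ i → d i * e i))))) ⟩
    ∑ (λ i → d i * y i) - ∑ (λ i → d i * e i) * x ∎

  δ : ∀ {n} → Fin n → Vector n
  δ fz     fz     = 1#
  δ fz     (fs _) = 0#
  δ (fs _) fz     = 0#
  δ (fs i) (fs j) = δ i j

  δ-sym : ∀ {n} (i j : Fin n) → δ i j ≡ δ j i
  δ-sym fz     fz     = ≡.refl
  δ-sym fz     (fs _) = ≡.refl
  δ-sym (fs _) fz     = ≡.refl
  δ-sym (fs i) (fs j) = δ-sym i j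

  ∑-δ : ∀ {n} (i : Fin n) (f : Fin n → Carrier) → ∑ (λ k → δ i k * f k) ≈ f i
  ∑-δ fz     f = trans (+-cong (*-identityˡ _) (∑-0 λ k → zeroˡ (f (fs k)))) (+-identityʳ _)
  ∑-δ (fs i) f = trans (+-cong (zeroˡ _) (∑-δ i (f ∘ fs))) (+-identityˡ _)

  -- Linear combinations and spans

  0ᵥ : ∀ {n} → Vector n
  0ᵥ _ = 0#

  negᵥ : ∀ {n} → Vector n → Vector n
  negᵥ v j = - v j

  _-ᵥ_ : ∀ {n} → Vector n → Vector n → Vector n
  (u -ᵥ v) j = u j - v j

  ≈ᵥ-refl : ∀ {n} {u : Vector n} → u ≈ᵥ u
  ≈ᵥ-refl _ = refl

  ≈ᵥ-sym : ∀ {n} {u v : Vector n} → u ≈ᵥ v → v ≈ᵥ u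
  ≈ᵥ-sym u≈v j = sym (u≈v j)

  ≈ᵥ-trans : ∀ {n} {u v w : Vector n} → u ≈ᵥ v → v ≈ᵥ w → u ≈ᵥ w
  ≈ᵥ-trans u≈v v≈w j = trans (u≈v j) (v≈w j)

  lincomb-cong : ∀ {k n} {cs cs′ : Fin k → Carrier} {v v′ : Fin k → Vector n} →
    (∀ i → cs i ≈ cs′ i) → (∀ i → v i ≈ᵥ v′ i) → lincomb cs v ≈ᵥ lincomb cs′ v′
  lincomb-cong cs≈ v≈ j = ∑-cong λ i → *-cong (cs≈ i) (v≈ i j)

  lincomb-congᶜ : ∀ {k n} {cs cs′ : Fin k → Carrier} (v : Fin k → Vector n) →
    (∀ i → cs i ≈ cs′ i) → lincomb cs v ≈ᵥ lincomb cs′ v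
  lincomb-congᶜ v cs≈ = lincomb-cong cs≈ λ _ → ≈ᵥ-refl

  lincomb-congᵛ : ∀ {k n} (cs : Fin k → Carrier) {v v′ : Fin k → Vector n} →
    (∀ i → v i ≈ᵥ v′ i) → lincomb cs v ≈ᵥ lincomb cs v′
  lincomb-congᵛ cs = lincomb-cong λ _ → refl

  lincomb-0ᶜ : ∀ {k n} {cs : Fin k → Carrier} (v : Fin k → Vector n) →
    (∀ i → cs i ≈ 0#) → lincomb cs v ≈ᵥ 0ᵥ
  lincomb-0ᶜ v cs≈0 j = ∑-0 λ i → trans (*-congʳ (cs≈0 i)) (zeroˡ _)

  lincomb-0ᵛ : ∀ {k n} (cs : Fin k → Carrier) {v : Fin k → Vector n} →
    (∀ i → v i ≈ᵥ 0ᵥ) → lincomb cs v ≈ᵥ 0ᵥ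
  lincomb-0ᵛ cs v≈0 j = ∑-0 λ i → trans (*-congˡ (v≈0 i j)) (zeroʳ (cs i))

  lincomb-negᶜ : ∀ {k n} (cs : Fin k → Carrier) (v : Fin k → Vector n) →
    lincomb (negᵥ cs) v ≈ᵥ negᵥ (lincomb cs v)
  lincomb-negᶜ cs v j =
    trans (∑-cong λ i → sym (-‿distribˡ-* (cs i) (v i j))) (sym (-‿distrib-∑ λ i → cs i * v i j))

  lincomb-negᵛ : ∀ {k n} (cs : Fin k → Carrier) (v : Fin k → Vector n) →
    lincomb cs (negᵥ ∘ v) ≈ᵥ negᵥ (lincomb cs v)
  lincomb-negᵛ cs v j =
    trans (∑-cong λ i → sym (-‿distribʳ-* (cs i) (v i j))) (sym (-‿distrib-∑ λ i → cs i * v i j))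

  lincomb-subᶜ : ∀ {k n} (cs ds : Fin k → Carrier) (v : Fin k → Vector n) →
    lincomb (cs -ᵥ ds) v ≈ᵥ (lincomb cs v -ᵥ lincomb ds v)
  lincomb-subᶜ cs ds v j = begin
    ∑ (λ i → (cs i - ds i) * v i j)
      ≈⟨ ∑-cong (λ i → distribʳ (v i j) (cs i) (- ds i)) ⟩
    ∑ (λ i → cs i * v i j + - ds i * v i j)
      ≈⟨ ∑-distrib-+ (λ i → cs i * v i j) (λ i → - ds i * v i j) ⟩
    lincomb cs v j + lincomb (negᵥ ds) v j
      ≈⟨ +-congˡ (lincomb-negᶜ ds v j) ⟩
    lincomb cs v j - lincomb ds v j ∎

  lincomb-assoc : ∀ {k m n} (cs : Fin k → Carrier) (D : Fin k → Vector m) (w : Fin m → Vector n) →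
    lincomb cs (λ i → lincomb (D i) w) ≈ᵥ lincomb (lincomb cs D) w
  lincomb-assoc cs D w j = begin
    ∑ (λ i → cs i * ∑ (λ l → D i l * w l j))
      ≈⟨ ∑-cong (λ i → *-distribˡ-∑ (cs i) (λ l → D i l * w l j)) ⟩
    ∑ (λ i → ∑ (λ l → cs i * (D i l * w l j)))
      ≈⟨ ∑-comm (λ i l → cs i * (D i l * w l j)) ⟩
    ∑ (λ l → ∑ (λ i → cs i * (D i l * w l j)))
      ≈⟨ ∑-cong (λ l → ∑-cong λ i → sym (*-assoc (cs i) (D i l) (w l j))) ⟩
    ∑ (λ l → ∑ (λ i → cs i * D i l * w l j))
      ≈⟨ ∑-cong (λ l → sym (*-distribʳ-∑ (w l j) (λ i → cs i * D i l))) ⟩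
    ∑ (λ l → lincomb cs D l * w l j) ∎

  lincomb-punchIn : ∀ {k n} (q : Fin (suc k)) (cs : Fin (suc k) → Carrier)
    (v : Fin (suc k) → Vector n) j →
    lincomb cs v j ≈ cs q * v q j + lincomb (cs ∘ punchIn q) (v ∘ punchIn q) j
  lincomb-punchIn q cs v j = ∑-punchIn q (λ i → cs i * v i j)

  lincomb-δ : ∀ {k n} (v : Fin k → Vector n) i → lincomb (δ i) v ≈ᵥ v i
  lincomb-δ v i j = ∑-δ i (λ l → v l j)

  lincomb-split : ∀ {m₁ m₂ n} (h : Vector (m₁ ℕ.+ m₂))
    (f : Fin m₁ → Vector n) (g : Fin m₂ → Vector n) →
    lincomb h (f ++ g) ≈ᵥ (lincomb (take m₁ h) f +ᵥ lincomb (drop m₁ h) g)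
  lincomb-split {m₁} h f g j = trans (∑-↑ m₁ _) (+-cong
    (∑-cong λ l → *-congˡ (reflexive (≡.cong (_$ j) (lookup-++ˡ f g l))))
    (∑-cong λ r → *-congˡ (reflexive (≡.cong (_$ j) (lookup-++ʳ f g r)))))

  lincomb-++ : ∀ {m₁ m₂ n} (cs : Vector m₁) (ds : Vector m₂)
    (f : Fin m₁ → Vector n) (g : Fin m₂ → Vector n) →
    lincomb (cs ++ ds) (f ++ g) ≈ᵥ (lincomb cs f +ᵥ lincomb ds g)
  lincomb-++ cs ds f g j = trans (lincomb-split (cs ++ ds) f g j) (+-cong
    (lincomb-congᶜ f (reflexive ∘ lookup-++ˡ cs ds) j)
    (lincomb-congᶜ g (reflexive ∘ lookup-++ʳ cs ds) j))

  lincomb-++ˡ : ∀ {k m₁ m₂} (cs : Fin k → Carrier)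
    (x : Fin k → Vector m₁) (y : Fin k → Vector m₂) l →
    lincomb cs (λ i → x i ++ y i) (l ↑ˡ m₂) ≈ lincomb cs x l
  lincomb-++ˡ cs x y l = ∑-cong λ i → *-congˡ (reflexive (lookup-++ˡ (x i) (y i) l))

  lincomb-++ʳ : ∀ {k m₁ m₂} (cs : Fin k → Carrier)
    (x : Fin k → Vector m₁) (y : Fin k → Vector m₂) r →
    lincomb cs (λ i → x i ++ y i) (m₁ ↑ʳ r) ≈ lincomb cs y r
  lincomb-++ʳ cs x y r = ∑-cong λ i → *-congˡ (reflexive (lookup-++ʳ (x i) (y i) r))

  RowSpace-resp : ∀ {k n} {w : Fin k → Vector n} {x y : Vector n} →
    x ≈ᵥ y → RowSpace w x → RowSpace w y
  RowSpace-resp x≈y (cs , x≈) = cs , ≈ᵥ-trans (≈ᵥ-sym x≈y) x≈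

  RowSpace-0 : ∀ {k n} (w : Fin k → Vector n) → RowSpace w 0ᵥ
  RowSpace-0 w = (λ _ → 0#) , ≈ᵥ-sym (lincomb-0ᶜ w λ _ → refl)

  RowSpace-∋ : ∀ {k n} (w : Fin k → Vector n) i → RowSpace w (w i)
  RowSpace-∋ w i = δ i , ≈ᵥ-sym (lincomb-δ w i)

  RowSpace-⊆ : ∀ {k m n} {v : Fin k → Vector n} {w : Fin m → Vector n} →
    (∀ i → RowSpace w (v i)) → ∀ {x} → RowSpace v x → RowSpace w x
  RowSpace-⊆ {w = w} v⊆w (cs , x≈) = lincomb cs (λ i → proj₁ (v⊆w i)) ,
    ≈ᵥ-trans x≈ (≈ᵥ-trans (lincomb-congᵛ cs λ i → proj₂ (v⊆w i)) (lincomb-assoc cs _ w))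

  ⊕-⊆-RowSpace-++ : ∀ {m₁ m₂ n} {f : Fin m₁ → Vector n} {g : Fin m₂ → Vector n} {x} →
    (RowSpace f ⊕ₛ RowSpace g) x → RowSpace (f ++ g) x
  ⊕-⊆-RowSpace-++ {f = f} {g} (_ , _ , (cs , y≈) , (ds , z≈) , x≈) =
    cs ++ ds , λ j → trans (x≈ j) (trans (+-cong (y≈ j) (z≈ j)) (sym (lincomb-++ cs ds f g j)))

  RowSpace-ᵀ : ∀ {m n p} {X : Matrix m n} {w : Fin p → Vector n} (G : Matrix m p) →
    (∀ i → X i ≈ᵥ lincomb (G i) w) → ∀ {x} → RowSpace (X ᵀ) x → RowSpace (G ᵀ) x
  RowSpace-ᵀ {X = X} {w} G X≈G·w {x} (cs , x≈) = lincomb cs (w ᵀ) , λ j → begin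
    x j                                            ≈⟨ x≈ j ⟩
    lincomb cs (X ᵀ) j                             ≈⟨ lincomb-congᵛ cs Xᵀ≈ j ⟩
    lincomb cs (λ q → lincomb ((w ᵀ) q) (G ᵀ)) j   ≈⟨ lincomb-assoc cs (w ᵀ) (G ᵀ) j ⟩
    lincomb (lincomb cs (w ᵀ)) (G ᵀ) j             ∎
    where
    Xᵀ≈ : ∀ q → (X ᵀ) q ≈ᵥ lincomb ((w ᵀ) q) (G ᵀ)
    Xᵀ≈ q i = trans (X≈G·w i q) (∑-cong λ l → *-comm (G i l) (w l q))

  -- Independence and Gaussian elimination

  -- Independence with a double-negated conclusion: in the absence of decidable
  -- equality this is what proofs by contradiction (pivoting, rank counting) deliver.
  WeaklyIndependent : ∀ {k n} → (Fin k → Vector n) → Set (c ⊔ ℓ)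
  WeaklyIndependent v = ∀ cs → (∀ j → lincomb cs v j ≈ 0#) → ∀ i → ¬ ¬ (cs i ≈ 0#)

  LinIndep⇒weak : ∀ {k n} {v : Fin k → Vector n} → LinIndep v → WeaklyIndependent v
  LinIndep⇒weak ind cs cs·v≈0 = return ∘ ind cs cs·v≈0

  δ-independent : ∀ {n} → WeaklyIndependent (δ {n})
  δ-independent cs cs·δ≈0 i = return (begin
    cs i                     ≈⟨ sym (∑-δ i cs) ⟩
    ∑ (λ k → δ i k * cs k)   ≈⟨ ∑-cong (λ k → trans (*-comm _ _) (*-congˡ (reflexive (δ-sym i k)))) ⟩
    lincomb cs δ i           ≈⟨ cs·δ≈0 i ⟩
    0#                       ∎)

  lincomb-injective : ∀ {k n} {v : Fin k → Vector n} → WeaklyIndependent v →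
    ∀ cs ds → lincomb cs v ≈ᵥ lincomb ds v → ∀ i → ¬ ¬ (cs i ≈ ds i)
  lincomb-injective {v = v} ind cs ds cs·v≈ds·v i = ¬¬-map (x∙y⁻¹≈ε⇒x≈y _ _)
    (ind (cs -ᵥ ds) (λ j → trans (lincomb-subᶜ cs ds v j) (x≈y⇒x∙y⁻¹≈ε (cs·v≈ds·v j))) i)

  coefficients-independent : ∀ {k m n} {v : Fin k → Vector n} {w : Fin m → Vector n}
    {cs : Fin k → Vector m} →
    (∀ i → v i ≈ᵥ lincomb (cs i) w) → WeaklyIndependent v → WeaklyIndependent cs
  coefficients-independent {v = v} {w} {cs} v≈ ind ds ds·cs≈0 = ind ds λ j → begin
    lincomb ds v j                          ≈⟨ lincomb-congᵛ ds v≈ j ⟩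
    lincomb ds (λ i → lincomb (cs i) w) j   ≈⟨ lincomb-assoc ds cs w j ⟩
    lincomb (lincomb ds cs) w j             ≈⟨ lincomb-0ᶜ w ds·cs≈0 j ⟩
    0#                                      ∎

  independent-tail : ∀ {k m} (C : Fin k → Vector (suc m)) → (∀ i → C i fz ≈ 0#) →
    WeaklyIndependent C → WeaklyIndependent (tail ∘ C)
  independent-tail C C-head≈0 ind cs cs·tail≈0 = ind cs λ where
    fz     → ∑-0 λ i → trans (*-congˡ (C-head≈0 i)) (zeroʳ (cs i))
    (fs j) → cs·tail≈0 j

  module Elimination {k m} (C : Fin (suc k) → Vector (suc m)) (p : Fin (suc k))
                     (pivot≉0 : ¬ C p fz ≈ 0#) where
    pivot⁻¹ : Carrier
    pivot⁻¹ = proj₁ (inverse (C p fz) pivot≉0)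

    factor : Fin k → Carrier
    factor i = C (punchIn p i) fz * pivot⁻¹

    reduced : Fin k → Vector m
    reduced i j = C (punchIn p i) (fs j) - factor i * C p (fs j)

    head-cleared : ∀ i → C (punchIn p i) fz - factor i * C p fz ≈ 0#
    head-cleared i = x≈y⇒x∙y⁻¹≈ε (begin
      C (punchIn p i) fz                        ≈⟨ sym (*-identityʳ _) ⟩
      C (punchIn p i) fz * 1#                   ≈⟨ *-congˡ (sym (proj₂ (inverse (C p fz) pivot≉0))) ⟩
      C (punchIn p i) fz * (C p fz * pivot⁻¹)   ≈⟨ *-congˡ (*-comm _ _) ⟩
      C (punchIn p i) fz * (pivot⁻¹ * C p fz)   ≈⟨ sym (*-assoc _ _ _) ⟩
      factor i * C p fz                         ∎)

    -- A relation ds among the reduced rows is a relation among the rows of C,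
    -- with coefficient σ on the pivot row.
    reduced-independent : WeaklyIndependent C → WeaklyIndependent reduced
    reduced-independent ind ds ds·reduced≈0 i =
      ¬¬-map (trans (sym (reflexive (insertAt-punchIn ds p σ i)))) (ind cs cs·C≈0 (punchIn p i))
      where
      σ : Carrier
      σ = - ∑ (λ i → ds i * factor i)
      cs : Fin (suc k) → Carrier
      cs = insertAt ds p σ
      row-operation : ∀ j → lincomb cs C j ≈ ∑ (λ i → ds i * (C (punchIn p i) j - factor i * C p j))
      row-operation j = begin
        lincomb cs C j
          ≈⟨ lincomb-punchIn p cs C j ⟩
        cs p * C p j + lincomb (cs ∘ punchIn p) (C ∘ punchIn p) j
          ≈⟨ +-cong (*-congʳ (reflexive (insertAt-lookup ds p σ)))
                    (lincomb-congᶜ (C ∘ punchIn p) (reflexive ∘ insertAt-punchIn ds p σ) j) ⟩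
        σ * C p j + lincomb ds (C ∘ punchIn p) j
          ≈⟨ trans (+-comm _ _) (+-congˡ (sym (-‿distribˡ-* _ _))) ⟩
        lincomb ds (C ∘ punchIn p) j - ∑ (λ i → ds i * factor i) * C p j
          ≈⟨ sym (∑-sub-scaled ds (λ i → C (punchIn p i) j) factor (C p j)) ⟩
        ∑ (λ i → ds i * (C (punchIn p i) j - factor i * C p j)) ∎
      cs·C≈0 : ∀ j → lincomb cs C j ≈ 0#
      cs·C≈0 fz     = trans (row-operation fz)
                            (∑-0 λ i → trans (*-congˡ (head-cleared i)) (zeroʳ (ds i)))
      cs·C≈0 (fs j) = trans (row-operation (fs j)) (ds·reduced≈0 j)

  independent⇒≤dim : ∀ {k m} (C : Fin k → Vector m) → WeaklyIndependent C → k ≤ m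
  independent⇒≤dim {zero}          _ _   = z≤n
  independent⇒≤dim {suc k} {zero}  C ind = ⊥-elim (ind (λ _ → 1#) (λ ()) fz (0≉1 ∘ sym))
  independent⇒≤dim {suc k} {suc m} C ind = ≤-stable do
    head≈0? ← ¬¬-∀Fin {P = λ i → Dec (C i fz ≈ 0#)} (λ _ → ¬¬-excluded-middle)
    return $ case all? head≈0? of λ where
      (yes head≈0) → m≤n⇒m≤1+n (independent⇒≤dim (tail ∘ C) (independent-tail C head≈0 ind))
      (no head≉0)  → let p , pivot≉0 = ¬∀⟶∃¬ _ _ head≈0? head≉0
                         open Elimination C p pivot≉0
                     in s≤s (independent⇒≤dim reduced (reduced-independent ind))

  steinitz : ∀ {k m n} (v : Fin k → Vector n) (w : Fin m → Vector n) →
    WeaklyIndependent v → (∀ i → ¬ ¬ RowSpace w (v i)) → k ≤ m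
  steinitz v w ind v∈⟨w⟩ = ≤-stable do
    coords ← ¬¬-∀Fin v∈⟨w⟩
    return (independent⇒≤dim (λ i → proj₁ (coords i))
                             (coefficients-independent (λ i → proj₂ (coords i)) ind))

  dim≤spanning : ∀ {m n d} {U : Pred n} (w : Fin m → Vector n) →
    HasDim U d → (∀ {x} → U x → ¬ ¬ RowSpace w x) → d ≤ m
  dim≤spanning w (v , v∈U , v-independent , _) U⊆⟨w⟩ =
    steinitz v w (LinIndep⇒weak v-independent) (U⊆⟨w⟩ ∘ v∈U)

  dim≤column-span : ∀ {m n p d} {U : Pred m} (X : Matrix m n) (w : Fin p → Vector n) →
    HasDim U d → (∀ {x} → U x → RowSpace (X ᵀ) x) → (∀ i → ¬ ¬ RowSpace w (X i)) → d ≤ p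
  dim≤column-span X w dimU U⊆columns rows∈⟨w⟩ = ≤-stable do
    G ← ¬¬-∀Fin rows∈⟨w⟩
    return (dim≤spanning _ dimU
      (return ∘ RowSpace-ᵀ (λ i → proj₁ (G i)) (λ i → proj₂ (G i)) ∘ U⊆columns))

  pivot∈span-of-rest : ∀ {k n} (v : Fin (suc k) → Vector n) cs → lincomb cs v ≈ᵥ 0ᵥ →
    ∀ p → ¬ cs p ≈ 0# → RowSpace (v ∘ punchIn p) (v p)
  pivot∈span-of-rest v cs cs·v≈0 p cs-p≉0 = μ , λ j → begin
    v p j                                ≈⟨ sym (trans (*-congʳ α·cs-p≈1) (*-identityˡ _)) ⟩
    α * cs p * v p j                     ≈⟨ *-assoc _ _ _ ⟩
    α * (cs p * v p j)                   ≈⟨ *-congˡ (inverseˡ-unique _ _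
                                              (trans (sym (lincomb-punchIn p cs v j)) (cs·v≈0 j))) ⟩
    α * - lincomb cs′ v′ j               ≈⟨ sym (-‿distribʳ-* _ _) ⟩
    - (α * lincomb cs′ v′ j)             ≈⟨ -‿cong (*-distribˡ-∑ α λ i → cs′ i * v′ i j) ⟩
    - ∑ (λ i → α * (cs′ i * v′ i j))     ≈⟨ -‿distrib-∑ (λ i → α * (cs′ i * v′ i j)) ⟩
    ∑ (λ i → - (α * (cs′ i * v′ i j)))   ≈⟨ ∑-cong (λ i → trans
                                              (-‿cong (sym (*-assoc α (cs′ i) (v′ i j))))
                                              (-‿distribˡ-* (α * cs′ i) (v′ i j))) ⟩
    lincomb μ v′ j                       ∎
    where
    α : Carrier
    α = proj₁ (inverse (cs p) cs-p≉0)
    α·cs-p≈1 : α * cs p ≈ 1#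
    α·cs-p≈1 = trans (*-comm _ _) (proj₂ (inverse (cs p) cs-p≉0))
    cs′ : Fin _ → Carrier
    cs′ = cs ∘ punchIn p
    v′ : Fin _ → Vector _
    v′ = v ∘ punchIn p
    μ : Fin _ → Carrier
    μ i = - (α * cs′ i)

  dependent⇒RowSpace⊆rest : ∀ {k n} (v : Fin (suc k) → Vector n) cs → lincomb cs v ≈ᵥ 0ᵥ →
    ∀ p → ¬ cs p ≈ 0# → ∀ {x} → RowSpace v x → RowSpace (v ∘ punchIn p) x
  dependent⇒RowSpace⊆rest v cs cs·v≈0 p cs-p≉0 = RowSpace-⊆ v∈rest
    where
    v∈rest : ∀ i → RowSpace (v ∘ punchIn p) (v i)
    v∈rest i with p ≟ᶠ i
    ... | yes ≡.refl = pivot∈span-of-rest v cs cs·v≈0 p cs-p≉0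
    ... | no p≢i     = RowSpace-resp (λ j → reflexive (≡.cong (λ q → v q j) (punchIn-punchOut p≢i)))
                                     (RowSpace-∋ (v ∘ punchIn p) (punchOut p≢i))

  rank⇒rows-independent : ∀ {k n} (X : Matrix k n) → Rank X k → WeaklyIndependent X
  rank⇒rows-independent {suc k} X rk cs cs·X≈0 p cs-p≉0 =
    1+n≰n (dim≤spanning (X ∘ punchIn p) rk (return ∘ dependent⇒RowSpace⊆rest X cs cs·X≈0 p cs-p≉0))

  rank⇒columns-independent : ∀ {m k} (X : Matrix m k) → Rank X k → WeaklyIndependent (X ᵀ)
  rank⇒columns-independent {k = suc k} X rk cs cs·Xᵀ≈0 p cs-p≉0 =
    1+n≰n (dim≤column-span (X ᵀ) ((X ᵀ) ∘ punchIn p) rk (λ x∈ → x∈) λ q →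
      return (dependent⇒RowSpace⊆rest (X ᵀ) cs cs·Xᵀ≈0 p cs-p≉0 (RowSpace-∋ (X ᵀ) q)))

  -- Sums and intersections of row spaces

  preimage-span : ∀ {N n s d} (Φ : Fin N → Vector n) {pre : Fin s → Vector N}
    {t : Fin s → Vector n} {κ : Fin d → Vector N} → (∀ k → lincomb (pre k) Φ ≈ᵥ t k) →
    (∀ h → lincomb h Φ ≈ᵥ 0ᵥ → ¬ ¬ RowSpace κ h) →
    ∀ {x} → RowSpace t (lincomb x Φ) → ¬ ¬ RowSpace (pre ++ κ) x
  preimage-span Φ {pre} {t} {κ} lifts kernel⊆⟨κ⟩ {x} (cs , x·Φ≈cs·t) = do
    ds , h≈ds·κ ← kernel⊆⟨κ⟩ h h·Φ≈0
    return (cs ++ ds , λ q → begin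
      x q                                 ≈⟨ sym (trans (+-comm _ _) (x-y+y≈x (x q) _)) ⟩
      lincomb cs pre q + h q              ≈⟨ +-congˡ (h≈ds·κ q) ⟩
      lincomb cs pre q + lincomb ds κ q   ≈⟨ sym (lincomb-++ cs ds pre κ q) ⟩
      lincomb (cs ++ ds) (pre ++ κ) q     ∎)
    where
    h : Vector _
    h = x -ᵥ lincomb cs pre
    h·Φ≈0 : lincomb h Φ ≈ᵥ 0ᵥ
    h·Φ≈0 j = trans (lincomb-subᶜ x (lincomb cs pre) Φ j) (x≈y⇒x∙y⁻¹≈ε (begin
      lincomb x Φ j                            ≈⟨ x·Φ≈cs·t j ⟩
      lincomb cs t j                           ≈⟨ lincomb-congᵛ cs (λ k → ≈ᵥ-sym (lifts k)) j ⟩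
      lincomb cs (λ k → lincomb (pre k) Φ) j   ≈⟨ lincomb-assoc cs pre Φ j ⟩
      lincomb (lincomb cs pre) Φ j             ∎))

  ++-independent : ∀ {N n s d} (Φ : Fin N → Vector n) {pre : Fin s → Vector N}
    {t : Fin s → Vector n} {κ : Fin d → Vector N} → (∀ k → lincomb (pre k) Φ ≈ᵥ t k) →
    WeaklyIndependent t → (∀ k → lincomb (κ k) Φ ≈ᵥ 0ᵥ) → WeaklyIndependent κ →
    WeaklyIndependent (pre ++ κ)
  ++-independent {s = s} {d} Φ {pre} {t} {κ} lifts t-independent κ·Φ≈0 κ-independent cs cs·[pre++κ]≈0 =
    splitAt-elim s cˡ≈0 λ r → do
      all-cˡ≈0 ← ¬¬-∀Fin cˡ≈0
      κ-independent cʳ (cʳ·κ≈0 all-cˡ≈0) r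
    where
    cˡ : Vector s
    cˡ = take s cs
    cʳ : Vector d
    cʳ = drop s cs
    cˡ·pre+cʳ·κ≈0 : ∀ j → lincomb cˡ pre j + lincomb cʳ κ j ≈ 0#
    cˡ·pre+cʳ·κ≈0 j = trans (sym (lincomb-split cs pre κ j)) (cs·[pre++κ]≈0 j)
    cˡ·t≈0 : ∀ j → lincomb cˡ t j ≈ 0#
    cˡ·t≈0 j = begin
      lincomb cˡ t j
        ≈⟨ lincomb-congᵛ cˡ (λ k → ≈ᵥ-sym (lifts k)) j ⟩
      lincomb cˡ (λ k → lincomb (pre k) Φ) j
        ≈⟨ lincomb-assoc cˡ pre Φ j ⟩
      lincomb (lincomb cˡ pre) Φ j
        ≈⟨ lincomb-congᶜ Φ (λ q → inverseˡ-unique _ _ (cˡ·pre+cʳ·κ≈0 q)) j ⟩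
      lincomb (negᵥ (lincomb cʳ κ)) Φ j
        ≈⟨ lincomb-negᶜ (lincomb cʳ κ) Φ j ⟩
      - lincomb (lincomb cʳ κ) Φ j
        ≈⟨ -‿cong (sym (lincomb-assoc cʳ κ Φ j)) ⟩
      - lincomb cʳ (λ k → lincomb (κ k) Φ) j
        ≈⟨ trans (-‿cong (lincomb-0ᵛ cʳ κ·Φ≈0 j)) ε⁻¹≈ε ⟩
      0# ∎
    cˡ≈0 : ∀ l → ¬ ¬ (cˡ l ≈ 0#)
    cˡ≈0 = t-independent cˡ cˡ·t≈0
    cʳ·κ≈0 : (∀ l → cˡ l ≈ 0#) → ∀ j → lincomb cʳ κ j ≈ 0#
    cʳ·κ≈0 all-cˡ≈0 j = trans (sym (+-identityˡ _))
      (trans (+-congʳ (sym (lincomb-0ᶜ pre all-cˡ≈0 j))) (cˡ·pre+cʳ·κ≈0 j))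

  -- h ↦ lincomb h Φ is the map (cs , ds) ↦ lincomb cs f − lincomb ds g; an intersection
  -- vector o = lincomb x f = lincomb y g gives the kernel vector κ = x ++ y.
  module DifferenceMap {m₁ m₂ n} (f : Fin m₁ → Vector n) (g : Fin m₂ → Vector n) where
    Φ : Fin (m₁ ℕ.+ m₂) → Vector n
    Φ = f ++ (negᵥ ∘ g)

    lincomb-Φ : ∀ cs ds → lincomb (cs ++ ds) Φ ≈ᵥ (lincomb cs f -ᵥ lincomb ds g)
    lincomb-Φ cs ds j = trans (lincomb-++ cs ds f (negᵥ ∘ g) j) (+-congˡ (lincomb-negᵛ ds g j))

    image⊆⊕ : ∀ h → (RowSpace f ⊕ₛ RowSpace g) (lincomb h Φ)
    image⊆⊕ h = _ , _ , (take m₁ h , ≈ᵥ-refl) , (negᵥ (drop m₁ h) , ≈ᵥ-refl) , λ j →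
      trans (lincomb-split h f (negᵥ ∘ g) j)
            (+-congˡ (trans (lincomb-negᵛ (drop m₁ h) g j) (sym (lincomb-negᶜ (drop m₁ h) g j))))

    ⊕⊆image : ∀ {x} → (RowSpace f ⊕ₛ RowSpace g) x → ∃ λ h → lincomb h Φ ≈ᵥ x
    ⊕⊆image {x} (_ , _ , (cs , y≈) , (ds , z≈) , x≈) = cs ++ negᵥ ds , λ j → begin
      lincomb (cs ++ negᵥ ds) Φ j
        ≈⟨ lincomb-Φ cs (negᵥ ds) j ⟩
      lincomb cs f j - lincomb (negᵥ ds) g j
        ≈⟨ +-congˡ (trans (-‿cong (lincomb-negᶜ ds g j)) (⁻¹-involutive _)) ⟩
      lincomb cs f j + lincomb ds g j
        ≈⟨ sym (trans (x≈ j) (+-cong (y≈ j) (z≈ j))) ⟩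
      x j ∎

    module _ {s : ℕ} {t : Fin s → Vector n} (t∈ : ∀ k → (RowSpace f ⊕ₛ RowSpace g) (t k)) where
      ⊕-lift : Fin s → Vector (m₁ ℕ.+ m₂)
      ⊕-lift k = proj₁ (⊕⊆image (t∈ k))

      lincomb-⊕-lift : ∀ k → lincomb (⊕-lift k) Φ ≈ᵥ t k
      lincomb-⊕-lift k = proj₂ (⊕⊆image (t∈ k))

    module _ {d : ℕ} {o : Fin d → Vector n} (o∈ : ∀ k → (RowSpace f ∩ₛ RowSpace g) (o k)) where
      private
        x : Fin d → Vector m₁
        x k = proj₁ (proj₁ (o∈ k))
        y : Fin d → Vector m₂
        y k = proj₁ (proj₂ (o∈ k))
        o≈x·f : ∀ k → o k ≈ᵥ lincomb (x k) f
        o≈x·f k = proj₂ (proj₁ (o∈ k))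
        o≈y·g : ∀ k → o k ≈ᵥ lincomb (y k) g
        o≈y·g k = proj₂ (proj₂ (o∈ k))

      κ : Fin d → Vector (m₁ ℕ.+ m₂)
      κ k = x k ++ y k

      lincomb-κ : ∀ k → lincomb (κ k) Φ ≈ᵥ 0ᵥ
      lincomb-κ k j =
        trans (lincomb-Φ (x k) (y k) j) (x≈y⇒x∙y⁻¹≈ε (trans (sym (o≈x·f k j)) (o≈y·g k j)))

      κ-independent : LinIndep o → WeaklyIndependent κ
      κ-independent o-independent ds ds·κ≈0 =
        coefficients-independent o≈x·f (LinIndep⇒weak o-independent) ds λ l →
          trans (sym (lincomb-++ˡ ds x y l)) (ds·κ≈0 (l ↑ˡ m₂))

      kernel⊆⟨κ⟩ : WeaklyIndependent f → WeaklyIndependent g →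
        Spans o (RowSpace f ∩ₛ RowSpace g) → ∀ h → lincomb h Φ ≈ᵥ 0ᵥ → ¬ ¬ RowSpace κ h
      kernel⊆⟨κ⟩ f-independent g-independent o-spans h h·Φ≈0 = do
        take≈ ← ¬¬-∀Fin (lincomb-injective f-independent (take m₁ h) (lincomb es x) L≈es·x·f)
        drop≈ ← ¬¬-∀Fin (lincomb-injective g-independent (drop m₁ h) (lincomb es y) R≈es·y·g)
        return (es , splitAt-elim m₁ (λ l → trans (take≈ l) (sym (lincomb-++ˡ es x y l)))
                                     (λ r → trans (drop≈ r) (sym (lincomb-++ʳ es x y r))))
        where
        L R : Vector n
        L = lincomb (take m₁ h) f
        R = lincomb (drop m₁ h) g
        L≈R : L ≈ᵥ R
        L≈R j = x∙y⁻¹≈ε⇒x≈y _ _ (trans (+-congˡ (sym (lincomb-negᵛ (drop m₁ h) g j)))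
                                  (trans (sym (lincomb-split h f (negᵥ ∘ g) j)) (h·Φ≈0 j)))
        L∈⟨o⟩ : RowSpace o L
        L∈⟨o⟩ = o-spans L ((take m₁ h , ≈ᵥ-refl) , (drop m₁ h , L≈R))
        es : Vector d
        es = proj₁ L∈⟨o⟩
        L≈es·x·f : L ≈ᵥ lincomb (lincomb es x) f
        L≈es·x·f = ≈ᵥ-trans (proj₂ L∈⟨o⟩) (≈ᵥ-trans (lincomb-congᵛ es o≈x·f) (lincomb-assoc es x f))
        R≈es·y·g : R ≈ᵥ lincomb (lincomb es y) g
        R≈es·y·g = ≈ᵥ-trans (≈ᵥ-sym L≈R)
          (≈ᵥ-trans (proj₂ L∈⟨o⟩) (≈ᵥ-trans (lincomb-congᵛ es o≈y·g) (lincomb-assoc es y g)))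

  module _ {m₁ m₂ n s d : ℕ} {f : Fin m₁ → Vector n} {g : Fin m₂ → Vector n} where
    open DifferenceMap f g

    dim-∩≤dim-⊕ : HasDim (RowSpace f ⊕ₛ RowSpace g) s → HasDim (RowSpace f ∩ₛ RowSpace g) d → d ≤ s
    dim-∩≤dim-⊕ (t , _ , _ , t-spans) dim∩ = dim≤spanning t dim∩ λ (x∈⟨f⟩ , _) →
      return (t-spans _ (_ , 0ᵥ , x∈⟨f⟩ , RowSpace-0 g , λ j → sym (+-identityʳ _)))

    dim-⊕+dim-∩≤ : HasDim (RowSpace f ⊕ₛ RowSpace g) s → HasDim (RowSpace f ∩ₛ RowSpace g) d →
      s ℕ.+ d ≤ m₁ ℕ.+ m₂
    dim-⊕+dim-∩≤ (t , t∈ , t-independent , _) (o , o∈ , o-independent , _) =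
      independent⇒≤dim (⊕-lift t∈ ++ κ o∈)
        (++-independent Φ (lincomb-⊕-lift t∈) (LinIndep⇒weak t-independent)
                          (lincomb-κ o∈) (κ-independent o∈ o-independent))

    ≤dim-⊕+dim-∩ : WeaklyIndependent f → WeaklyIndependent g →
      HasDim (RowSpace f ⊕ₛ RowSpace g) s → HasDim (RowSpace f ∩ₛ RowSpace g) d →
      m₁ ℕ.+ m₂ ≤ s ℕ.+ d
    ≤dim-⊕+dim-∩ f-independent g-independent (t , t∈ , _ , t-spans) (o , o∈ , _ , o-spans) =
      steinitz δ (⊕-lift t∈ ++ κ o∈) δ-independent λ q →
        preimage-span Φ (lincomb-⊕-lift t∈) (kernel⊆⟨κ⟩ o∈ f-independent g-independent o-spans)
          (t-spans _ (image⊆⊕ (δ q)))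

    grassmann : WeaklyIndependent f → WeaklyIndependent g →
      HasDim (RowSpace f ⊕ₛ RowSpace g) s → HasDim (RowSpace f ∩ₛ RowSpace g) d →
      s ℕ.+ d ≡ m₁ ℕ.+ m₂
    grassmann f-independent g-independent dim⊕ dim∩ =
      ≤-antisym (dim-⊕+dim-∩≤ dim⊕ dim∩) (≤dim-⊕+dim-∩ f-independent g-independent dim⊕ dim∩)

  dim-⊕≤rank+dim-∩ : ∀ {a u b s d r} (A₁ B₁ : Matrix a u) (A₂ B₂ : Matrix u b) →
    WeaklyIndependent A₂ → WeaklyIndependent B₂ →
    HasDim (RowSpace (A₁ ᵀ) ⊕ₛ RowSpace (B₁ ᵀ)) s → HasDim (RowSpace A₂ ∩ₛ RowSpace B₂) d →
    Rank ((A₁ ⊗ A₂) ⊖ (B₁ ⊗ B₂)) r → s ≤ r ℕ.+ d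
  dim-⊕≤rank+dim-∩ {a} {u} {r = r} A₁ B₁ A₂ B₂ A₂-independent B₂-independent dim⊕
                   (o , o∈ , _ , o-spans) (ρ , ρ∈ , _ , ρ-spans) =
    dim≤column-span X (lift ++ κ o∈) dim⊕ ⊕-⊆-RowSpace-++ rows∈
    where
    open DifferenceMap A₂ B₂
    M : Matrix a _
    M = (A₁ ⊗ A₂) ⊖ (B₁ ⊗ B₂)
    X : Matrix a (u ℕ.+ u)
    X = (A₁ ᵀ ++ B₁ ᵀ) ᵀ
    X·Φ≈M : ∀ i → lincomb (X i) Φ ≈ᵥ M i
    X·Φ≈M i j = begin
      lincomb (X i) Φ j
        ≈⟨ lincomb-split (X i) A₂ (negᵥ ∘ B₂) j ⟩
      lincomb (take u (X i)) A₂ j + lincomb (drop u (X i)) (negᵥ ∘ B₂) j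
        ≈⟨ +-cong
             (lincomb-congᶜ A₂ (λ l → reflexive (≡.cong (_$ i) (lookup-++ˡ (A₁ ᵀ) (B₁ ᵀ) l))) j)
             (lincomb-congᶜ (negᵥ ∘ B₂)
               (λ r → reflexive (≡.cong (_$ i) (lookup-++ʳ (A₁ ᵀ) (B₁ ᵀ) r))) j) ⟩
      lincomb (A₁ i) A₂ j + lincomb (B₁ i) (negᵥ ∘ B₂) j
        ≈⟨ +-congˡ (lincomb-negᵛ (B₁ i) B₂ j) ⟩
      M i j ∎
    lift : Fin r → Vector (u ℕ.+ u)
    lift k = lincomb (proj₁ (ρ∈ k)) X
    lincomb-lift : ∀ k → lincomb (lift k) Φ ≈ᵥ ρ k
    lincomb-lift k = ≈ᵥ-trans (≈ᵥ-sym (lincomb-assoc (proj₁ (ρ∈ k)) X Φ))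
                     (≈ᵥ-trans (lincomb-congᵛ _ X·Φ≈M) (≈ᵥ-sym (proj₂ (ρ∈ k))))
    rows∈ : ∀ i → ¬ ¬ RowSpace (lift ++ κ o∈) (X i)
    rows∈ i = preimage-span Φ lincomb-lift (kernel⊆⟨κ⟩ o∈ A₂-independent B₂-independent o-spans)
      (ρ-spans _ (RowSpace-resp (≈ᵥ-sym (X·Φ≈M i)) (RowSpace-∋ M i)))

open import Data.Nat using (_+_; _*_; _∸_)

-- Since s₁ + i₁ = s₂ + i₂, the two differences add up to 2 (s₁ ∸ i₂).
sum-of-differences≤ : ∀ {n s₁ i₁ s₂ i₂ r} → s₁ + i₁ ≡ n → s₂ + i₂ ≡ n →
  i₁ ≤ s₁ → i₂ ≤ s₂ → s₁ ≤ r + i₂ → (s₁ ∸ i₁) + (s₂ ∸ i₂) ≤ 2 * r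
sum-of-differences≤ {n} {s₁} {i₁} {s₂} {i₂} {r} sum₁ sum₂ i₁≤s₁ i₂≤s₂ s₁≤r+i₂ =
  +-cancelʳ-≤ (i₂ + i₂) (x + y) (2 * r) $ begin
    (x + y) + (i₂ + i₂)   ≡⟨ shuffle₁ x y i₂ ⟩
    x + ((i₂ + y) + i₂)   ≡⟨ ≡.cong (λ t → x + (t + i₂)) (m+[n∸m]≡n i₂≤s₂) ⟩
    x + (s₂ + i₂)         ≡⟨ ≡.cong (x +_) (≡.trans sum₂ (≡.sym sum₁)) ⟩
    x + (s₁ + i₁)         ≡⟨ ≡.cong (λ t → x + (t + i₁)) (≡.sym (m+[n∸m]≡n i₁≤s₁)) ⟩
    x + ((i₁ + x) + i₁)   ≡⟨ shuffle₂ x i₁ ⟩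
    (i₁ + x) + (i₁ + x)   ≡⟨ ≡.cong₂ _+_ (m+[n∸m]≡n i₁≤s₁) (m+[n∸m]≡n i₁≤s₁) ⟩
    s₁ + s₁               ≤⟨ +-mono-≤ s₁≤r+i₂ s₁≤r+i₂ ⟩
    (r + i₂) + (r + i₂)   ≡⟨ shuffle₃ r i₂ ⟩
    2 * r + (i₂ + i₂)     ∎
  where
  open ≤-Reasoning
  x y : ℕ
  x = s₁ ∸ i₁
  y = s₂ ∸ i₂
  shuffle₁ : ∀ x y z → (x + y) + (z + z) ≡ x + ((z + y) + z)
  shuffle₁ = solve-∀
  shuffle₂ : ∀ x z → x + ((z + x) + z) ≡ (z + x) + (z + x)
  shuffle₂ = solve-∀
  shuffle₃ : ∀ x z → (x + z) + (x + z) ≡ 2 * x + (z + z)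
  shuffle₃ = solve-∀

lemma14 : {c ℓ : Level} (F : FiniteField c ℓ) → let open LinAlg F in
    {a b u : ℕ} (A₁ B₁ : Matrix a u) (A₂ B₂ : Matrix u b) →
    Rank A₁ u → Rank A₂ u → Rank B₁ u → Rank B₂ u →
    (s₁ i₁ s₂ i₂ r : ℕ) →
    HasDim (RowSpace (A₁ ᵀ) ⊕ₛ RowSpace (B₁ ᵀ)) s₁ →
    HasDim (RowSpace (A₁ ᵀ) ∩ₛ RowSpace (B₁ ᵀ)) i₁ →
    HasDim (RowSpace A₂ ⊕ₛ RowSpace B₂) s₂ →
    HasDim (RowSpace A₂ ∩ₛ RowSpace B₂) i₂ →
    Rank ((A₁ ⊗ A₂) ⊖ (B₁ ⊗ B₂)) r →
    (s₁ ∸ i₁) + (s₂ ∸ i₂) ≤ 2 * r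
lemma14 F A₁ B₁ A₂ B₂ rk-A₁ rk-A₂ rk-B₁ rk-B₂ _ _ _ _ _ dim⊕₁ dim∩₁ dim⊕₂ dim∩₂ rk-M =
  sum-of-differences≤
    (grassmann A₁-columns B₁-columns dim⊕₁ dim∩₁)
    (grassmann A₂-rows B₂-rows dim⊕₂ dim∩₂)
    (dim-∩≤dim-⊕ dim⊕₁ dim∩₁)
    (dim-∩≤dim-⊕ dim⊕₂ dim∩₂)
    (dim-⊕≤rank+dim-∩ A₁ B₁ A₂ B₂ A₂-rows B₂-rows dim⊕₁ dim∩₂ rk-M)
  where
  open LinAlg F
  open LinearAlgebra F
  A₁-columns : WeaklyIndependent (A₁ ᵀ)
  A₁-columns = rank⇒columns-independent A₁ rk-A₁
  B₁-columns : WeaklyIndependent (B₁ ᵀ)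
  B₁-columns = rank⇒columns-independent B₁ rk-B₁
  A₂-rows : WeaklyIndependent A₂
  A₂-rows = rank⇒rows-independent A₂ rk-A₂
  B₂-rows : WeaklyIndependent B₂
  B₂-rows = rank⇒rows-independent B₂ rk-B₂
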